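{- For every integer $n\ge 0$, $$\#E\Pi_n(13/2,123)=\begin{cases}\lceil F_n/2\rceil & n\equiv0,1 \pmod 6,\\ F_n/2 & n\equiv 2,5 \pmod 6,\\ \lfloor F_n/2\rfloor & n\equiv 3,4\pmod 6,\end{cases}\qquad \#O\Pi_n(13/2,123)=\begin{cases}\lfloor F_n/2\rfloor & n\equiv0,1 \pmod 6,\\ F_n/2 & n\equiv 2,5 \pmod 6,\\ \lceil F_n/2\rceil & n\equiv 3,4\pmod 6.\end{cases}$$
   Context: $\Pi_n$ is the set of set partitions of $[n]=\{1,\dots,n\}$ ($\Pi_0$ consists of the empty partition, which has $0$ blocks). For $\pi\in\Pi_m$ and $\sigma\in\Pi_n$, $\sigma$ contains the pattern $\pi$ if there is $S\subseteq[n]$ with $\#S=m$ such that the restriction $\{B\cap S: B\in\sigma,\ B\cap S\neq\emptyset\}$, relabeled by the order-preserving bijection $S\to[m]$, equals $\pi$; otherwise $\sigma$ avoids $\pi$. $\Pi_n(R)$ is the set of $\sigma\in\Pi_n$ avoiding every pattern in $R$; here $13/2=\{\{1,3\},\{2\}\}$ and $123=\{\{1,2,3\}\}$. The sign of $\sigma\in\Pi_n$ with $k$ blocks is $(-1)^{n-k}$; $\sigma$ is even if its sign is $1$ and odd if it is $-1$. $E\Pi_n(R)$ and $O\Pi_n(R)$ denote the sets of even, respectively odd, partitions in $\Pi_n(R)$. $F_n$ are the Fibonacci numbers with $F_0=F_1=1$, $F_n=F_{n-1}+F_{n-2}$. -}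

module Defs where

open import Data.Bool using (Bool; true; false; not; _∧_)
open import Data.Nat using (ℕ; zero; suc; _+_; _∸_; _<ᵇ_; _%_)
open import Data.Fin using (Fin; toℕ; _<_)
open import Data.Fin.Patterns using (0F; 1F; 2F)
open import Data.Vec using (Vec; lookup; tabulate)
open import Data.List using (List; []; _∷_; length; filterᵇ; allFin)
open import Data.List.Membership.Propositional using (_∈_)
open import Data.List.Relation.Unary.Unique.Propositional using (Unique)
open import Data.Product using (Σ; _×_; ∃)
open import Function.Bundles using (_⇔_)
open import Relation.Binary.PropositionalEquality using (_≡_)
open import Relation.Nullary using (¬_)

-- A set partition of [n] is encoded by its equivalence relation "lie in the
-- same block", stored as an n×n Boolean matrix (index i : Fin n stands for i+1).
Rel : ℕ → Set
Rel n = Vec (Vec Bool n) n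

rel : ∀ {n} → Rel n → Fin n → Fin n → Bool
rel σ i j = lookup (lookup σ i) j

record IsSetPartition {n : ℕ} (σ : Rel n) : Set where
  field
    refl'  : ∀ i → rel σ i i ≡ true
    sym'   : ∀ i j → rel σ i j ≡ true → rel σ j i ≡ true
    trans' : ∀ i j k → rel σ i j ≡ true → rel σ j k ≡ true → rel σ i k ≡ true

-- σ contains π : there is S ⊆ [n] with #S = m, given by a strictly increasing
-- f : [m] → [n] (the inverse of the order-preserving relabelling S → [m]),
-- such that the restriction of σ to S, relabelled, is π.
Contains : ∀ {m n} → Rel n → Rel m → Set
Contains {m} {n} σ π =
  Σ (Fin m → Fin n) λ f →
    (∀ i j → i < j → f i < f j) × (∀ i j → rel π i j ≡ rel σ (f i) (f j))

Avoids : ∀ {m n} → Rel n → Rel m → Set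
Avoids σ π = ¬ Contains σ π

allᵇ : {A : Set} → (A → Bool) → List A → Bool
allᵇ p [] = true
allᵇ p (x ∷ xs) = p x ∧ allᵇ p xs

-- number of blocks = number of elements that are the minimum of their block
blocks : ∀ {n} → Rel n → ℕ
blocks {n} σ =
  length (filterᵇ (λ i → allᵇ (λ j → not ((toℕ j <ᵇ toℕ i) ∧ rel σ j i)) (allFin n)) (allFin n))

-- sign (-1)^(n-k): even iff n - k is even
Even : ∀ {n} → Rel n → Set
Even {n} σ = (n ∸ blocks σ) % 2 ≡ 0

Odd : ∀ {n} → Rel n → Set
Odd {n} σ = (n ∸ blocks σ) % 2 ≡ 1

p13/2 : Rel 3
p13/2 = tabulate λ i → tabulate λ j → f i j
  where
  f : Fin 3 → Fin 3 → Bool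
  f 1F 1F = true
  f 1F _  = false
  f _  1F = false
  f _  _  = true

p123 : Rel 3
p123 = tabulate λ _ → tabulate λ _ → true

InΠ : ∀ {n} → Rel n → Set
InΠ σ = IsSetPartition σ × Avoids σ p13/2 × Avoids σ p123

HasCard : {A : Set} → (A → Set) → ℕ → Set
HasCard {A} P k =
  Σ (List A) λ xs → Unique xs × length xs ≡ k × (∀ x → (x ∈ xs) ⇔ P x)

-- Fibonacci with F_0 = F_1 = 1
F : ℕ → ℕ
F zero = 1
F (suc zero) = 1
F (suc (suc n)) = F (suc n) + F n

{-# OPTIONS --safe #-}
-- Avoiding 123 and 13/2 forces every block to be {i} or {i, i+1}: if i and j ≥ i + 2
-- share a block, then i, i + 1, j form the pattern 123 or 13/2. So Π_n(13/2, 123) is in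
-- bijection with the tilings of a 1 × n strip by monominoes and dominoes, which are
-- counted by F_n, and the sign of a partition is (-1)^(number of dominoes). Splitting by
-- the first tile, the even and odd counts satisfy e_{n+2} = e_{n+1} + o_n and
-- o_{n+2} = o_{n+1} + e_n, so d_n = e_n - o_n obeys d_{n+2} = d_{n+1} - d_n; hence d is
-- 6-periodic with values 1, 1, 0, -1, -1, 0, and e_n + o_n = F_n gives both counts.
module Submission where

open import Defs
open import Algebra.Properties.CommutativeSemigroup using (interchange)
open import Data.Empty using (⊥)
open import Data.Bool using (Bool; true; false; not; _∧_; if_then_else_)
open import Data.Bool.Properties using (T-≡; ¬-not; not-¬)
open import Data.Fin using (Fin; zero; suc; toℕ; fromℕ<; _<_)
open import Data.Fin.Patterns using (0F; 1F; 2F)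
open import Data.Fin.Properties using (toℕ<n; toℕ-fromℕ<; <-trans)
import Data.Fin as Fin
open import Data.Integer using (ℤ; +_; -_; _-_)
import Data.Integer as ℤ
open import Data.Integer.Properties using (+-injective; neg-involutive; pos-+)
open import Data.Integer.Tactic.RingSolver using (solve-∀)
open import Data.List using (List; []; _∷_; _++_; length; map; filterᵇ; allFin)
import Data.List as List
open import Data.List.Membership.Propositional using (_∈_)
open import Data.List.Membership.Propositional.Properties using (∈-map⁺; ∈-map⁻; ∈-++⁺ˡ; ∈-++⁺ʳ; ∈-++⁻)
open import Data.List.Properties using (length-map; length-++)
open import Data.List.Relation.Unary.Any using (here)
open import Data.List.Relation.Unary.AllPairs using ([]; _∷_)
open import Data.List.Relation.Unary.All using ([])
open import Data.List.Relation.Unary.Unique.Propositional using (Unique)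
import Data.List.Relation.Unary.Unique.Propositional.Properties as Unique
open import Data.Nat using (ℕ; zero; suc; _+_; _*_; _∸_; _%_; _/_; _≤_; _≡ᵇ_; _<ᵇ_; z≤n; s≤s; s≤s⁻¹; parity)
open import Data.Nat.DivMod using ([m+n]%n≡m%n; %-congˡ; m*n/n≡m; +-distrib-/-∣ʳ)
open import Data.Nat.Divisibility using (n∣m*n)
open import Data.Nat.Properties using (≡ᵇ⇒≡; ≡⇒≡ᵇ; +-comm; +-suc; +-identityʳ; ≤-trans; <⇒≤; ≤-reflexive; m+n∸m≡n; +-commutativeSemigroup)
import Data.Nat as ℕ
open import Data.Nat.Tactic.RingSolver using () renaming (solve-∀ to ℕ-solve-∀)
open import Data.Parity using (Parity; 0ℙ; 1ℙ; _⁻¹)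
open import Data.Parity.Properties using (suc-homo-⁻¹; ⁻¹-injective)
open import Data.Product using (Σ; _×_; _,_; swap)
open import Data.Sum using (_⊎_; inj₁; inj₂; [_,_]′)
open import Data.Vec using (lookup; tabulate; _∷_; [])
open import Data.Vec.Properties using (lookup∘tabulate; tabulate∘lookup; tabulate-cong)
open import Function using (id; _∘_; _⇔_; mk⇔; Equivalence)
open import Relation.Binary.Structures using (IsEquivalence)
import Relation.Binary.Construct.On as On
open import Relation.Binary.PropositionalEquality
open import Relation.Nullary using (¬_; contradiction)

private
  variable
    n : ℕ

tabulate² : (Fin n → Fin n → Bool) → Rel n
tabulate² r = tabulate λ i → tabulate (r i)

rel-tabulate² : (r : Fin n → Fin n → Bool) → ∀ i j → rel (tabulate² r) i j ≡ r i j
rel-tabulate² r i j = trans (cong (λ row → lookup row j) (lookup∘tabulate _ i)) (lookup∘tabulate (r i) j)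

tabulate²-rel : {σ : Rel n} {r : Fin n → Fin n → Bool} → (∀ i j → rel σ i j ≡ r i j) → σ ≡ tabulate² r
tabulate²-rel {σ = σ} eq = trans (sym (tabulate∘lookup σ))
  (tabulate-cong λ i → trans (sym (tabulate∘lookup (lookup σ i))) (tabulate-cong (eq i)))

IsEquivalenceᵇ : {A : Set} → (A → A → Bool) → Set
IsEquivalenceᵇ r = IsEquivalence (λ i j → r i j ≡ true)

isSetPartition⇒isEquivalenceᵇ : {σ : Rel n} → IsSetPartition σ → IsEquivalenceᵇ (rel σ)
isSetPartition⇒isEquivalenceᵇ P = record
  { refl = refl' _ ; sym = sym' _ _ ; trans = trans' _ _ _ }
  where open IsSetPartition P

isEquivalenceᵇ⇒isSetPartition : {r : Fin n → Fin n → Bool} → IsEquivalenceᵇ r → IsSetPartition (tabulate² r)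
isEquivalenceᵇ⇒isSetPartition {r = r} E = record
  { refl'  = λ i → to (IsEquivalence.refl E)
  ; sym'   = λ i j → to ∘ IsEquivalence.sym E ∘ from
  ; trans' = λ i j k p q → to (IsEquivalence.trans E (from p) (from q))
  }
  where
  to : ∀ {i j} → r i j ≡ true → rel (tabulate² r) i j ≡ true
  to = trans (rel-tabulate² r _ _)
  from : ∀ {i j} → rel (tabulate² r) i j ≡ true → r i j ≡ true
  from = trans (sym (rel-tabulate² r _ _))

rel-sym : {σ : Rel n} → IsSetPartition σ → ∀ i j → rel σ i j ≡ rel σ j i
rel-sym {σ = σ} P i j with rel σ i j in ij | rel σ j i in ji
... | true  | true  = refl
... | false | false = refl
... | true  | false = contradiction (IsSetPartition.sym' P i j ij) (not-¬ ji)
... | false | true  = contradiction (IsSetPartition.sym' P j i ji) (not-¬ ij)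

kernel : {A : Set} → (A → ℕ) → A → A → Bool
kernel ℓ x y = ℓ x ≡ᵇ ℓ y

kernel-isEquivalenceᵇ : {A : Set} (ℓ : A → ℕ) → IsEquivalenceᵇ (kernel ℓ)
kernel-isEquivalenceᵇ ℓ = record
  { refl  = from refl
  ; sym   = λ p → from (sym (to p))
  ; trans = λ p q → from (trans (to p) (to q))
  }
  where
  to : ∀ {i j} → kernel ℓ i j ≡ true → ℓ i ≡ ℓ j
  to = ≡ᵇ⇒≡ _ _ ∘ Equivalence.from T-≡
  from : ∀ {i j} → ℓ i ≡ ℓ j → kernel ℓ i j ≡ true
  from = Equivalence.to T-≡ ∘ ≡⇒≡ᵇ _ _

-- Short blocks and the patterns 13/2, 123

HasShortBlocks : (Fin n → Fin n → Bool) → Set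
HasShortBlocks r = ∀ i j → 2 + toℕ i ≤ toℕ j → r i j ≡ false

hasShortBlocks⇒avoids : {σ : Rel n} (π : Rel 3) → rel π 0F 2F ≡ true → HasShortBlocks (rel σ) → Avoids σ π
hasShortBlocks⇒avoids π π₀₂ short (f , increasing , agree) =
  not-¬ (short (f 0F) (f 2F) f₀+2≤f₂) (trans (sym (agree 0F 2F)) π₀₂)
  where
  f₀+2≤f₂ : 2 + toℕ (f 0F) ≤ toℕ (f 2F)
  f₀+2≤f₂ = ≤-trans (s≤s (increasing 0F 1F (s≤s z≤n))) (increasing 1F 2F (s≤s (s≤s z≤n)))

lookup₃-increasing : {i j k : Fin n} → i < j → j < k →
                     ∀ a b → a < b → lookup (i ∷ j ∷ k ∷ []) a < lookup (i ∷ j ∷ k ∷ []) b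
lookup₃-increasing i<j j<k 0F 1F _ = i<j
lookup₃-increasing i<j j<k 0F 2F _ = <-trans i<j j<k
lookup₃-increasing i<j j<k 1F 2F _ = j<k
lookup₃-increasing i<j j<k 0F 0F ()
lookup₃-increasing i<j j<k 1F 0F ()
lookup₃-increasing i<j j<k 1F 1F (s≤s ())
lookup₃-increasing i<j j<k 2F 0F ()
lookup₃-increasing i<j j<k 2F 1F (s≤s ())
lookup₃-increasing i<j j<k 2F 2F (s≤s (s≤s ()))

inΠ⇒hasShortBlocks : {σ : Rel n} → InΠ σ → HasShortBlocks (rel σ)
inΠ⇒hasShortBlocks {n} {σ} (P , avoids13/2 , avoids123) i j i+2≤j = ¬-not λ i~j → middle (rel σ i k) refl i~j
  where
  open IsSetPartition P
  k<n : suc (toℕ i) ℕ.< n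
  k<n = ≤-trans i+2≤j (<⇒≤ (toℕ<n j))
  k : Fin n
  k = fromℕ< k<n
  f : Fin 3 → Fin n
  f = lookup (i ∷ k ∷ j ∷ [])
  f-increasing : ∀ a b → a < b → f a < f b
  f-increasing = lookup₃-increasing (≤-reflexive (sym (toℕ-fromℕ< k<n)))
                                    (subst (λ m → suc m ≤ toℕ j) (sym (toℕ-fromℕ< k<n)) i+2≤j)
  middle : ∀ b → rel σ i k ≡ b → rel σ i j ≡ true → ⊥
  middle true i~k i~j = avoids123 (f , f-increasing , agree)
    where
    i~ : ∀ a → rel σ i (f a) ≡ true
    i~ 0F = refl' i
    i~ 1F = i~k
    i~ 2F = i~j
    agree : ∀ a b → rel p123 a b ≡ rel σ (f a) (f b)
    agree a b = trans (rel-tabulate² _ a b) (sym (trans' _ _ _ (sym' _ _ (i~ a)) (i~ b)))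
  middle false i≁k i~j = avoids13/2 (f , f-increasing , agree)
    where
    k≁j : rel σ k j ≡ false
    k≁j = ¬-not λ k~j → not-¬ i≁k (trans' i j k i~j (sym' k j k~j))
    agree : ∀ a b → rel p13/2 a b ≡ rel σ (f a) (f b)
    agree 0F 0F = sym (refl' i)
    agree 0F 1F = sym i≁k
    agree 0F 2F = sym i~j
    agree 1F 0F = trans (agree 0F 1F) (rel-sym P i k)
    agree 1F 1F = sym (refl' k)
    agree 1F 2F = sym k≁j
    agree 2F 0F = trans (agree 0F 2F) (rel-sym P i j)
    agree 2F 1F = trans (agree 1F 2F) (rel-sym P k j)
    agree 2F 2F = sym (refl' j)

-- Tilings by monominoes and dominoes

data Tiling : ℕ → Set where
  end    : Tiling 0
  mono   : Tiling n → Tiling (suc n)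
  domino : Tiling n → Tiling (2 + n)

tile : Tiling n → Fin n → ℕ
tile (mono t)   zero          = 0
tile (mono t)   (suc i)       = suc (tile t i)
tile (domino t) zero          = 0
tile (domino t) (suc zero)    = 0
tile (domino t) (suc (suc i)) = suc (tile t i)

sameTile : Tiling n → Fin n → Fin n → Bool
sameTile t = kernel (tile t)

⟦_⟧ : Tiling n → Rel n
⟦ t ⟧ = tabulate² (sameTile t)

dominoes : Tiling n → ℕ
dominoes end        = 0
dominoes (mono t)   = dominoes t
dominoes (domino t) = suc (dominoes t)

sameTile-hasShortBlocks : (t : Tiling n) → HasShortBlocks (sameTile t)
sameTile-hasShortBlocks (mono t)   zero          (suc j)       _  = refl
sameTile-hasShortBlocks (mono t)   (suc i)       (suc j)       le = sameTile-hasShortBlocks t i j (s≤s⁻¹ le)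
sameTile-hasShortBlocks (domino t) zero          (suc (suc j)) _  = refl
sameTile-hasShortBlocks (domino t) (suc zero)    (suc (suc j)) _  = refl
sameTile-hasShortBlocks (domino t) (suc (suc i)) (suc (suc j)) le = sameTile-hasShortBlocks t i j (s≤s⁻¹ (s≤s⁻¹ le))
sameTile-hasShortBlocks (mono t)   zero          zero          ()
sameTile-hasShortBlocks (mono t)   (suc i)       zero          ()
sameTile-hasShortBlocks (domino t) zero          zero          ()
sameTile-hasShortBlocks (domino t) zero          (suc zero)    (s≤s ())
sameTile-hasShortBlocks (domino t) (suc zero)    zero          ()
sameTile-hasShortBlocks (domino t) (suc zero)    (suc zero)    (s≤s ())
sameTile-hasShortBlocks (domino t) (suc (suc i)) zero          ()
sameTile-hasShortBlocks (domino t) (suc (suc i)) (suc zero)    (s≤s ())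

sameTile-injective : {s t : Tiling n} → (∀ i j → sameTile s i j ≡ sameTile t i j) → s ≡ t
sameTile-injective {s = end}      {end}      _  = refl
sameTile-injective {s = mono s}   {mono t}   eq = cong mono (sameTile-injective λ i j → eq (suc i) (suc j))
sameTile-injective {s = mono s}   {domino t} eq = contradiction (eq 0F 1F) λ ()
sameTile-injective {s = domino s} {mono t}   eq = contradiction (eq 0F 1F) λ ()
sameTile-injective {s = domino s} {domino t} eq =
  cong domino (sameTile-injective λ i j → eq (suc (suc i)) (suc (suc j)))

⟦⟧-injective : {s t : Tiling n} → ⟦ s ⟧ ≡ ⟦ t ⟧ → s ≡ t
⟦⟧-injective {s = s} {t} eq = sameTile-injective λ i j →
  trans (sym (rel-tabulate² (sameTile s) i j)) (trans (cong (λ σ → rel σ i j) eq) (rel-tabulate² (sameTile t) i j))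

⟦⟧-inΠ : (t : Tiling n) → InΠ ⟦ t ⟧
⟦⟧-inΠ t = isEquivalenceᵇ⇒isSetPartition (kernel-isEquivalenceᵇ (tile t))
         , hasShortBlocks⇒avoids {σ = ⟦ t ⟧} p13/2 refl short
         , hasShortBlocks⇒avoids {σ = ⟦ t ⟧} p123 refl short
  where
  short : HasShortBlocks (rel ⟦ t ⟧)
  short i j le = trans (rel-tabulate² (sameTile t) i j) (sameTile-hasShortBlocks t i j le)

Describes : Tiling n → (Fin n → Fin n → Bool) → Set
Describes t r = ∀ i j → r i j ≡ sameTile t i j

shift : (Fin (suc n) → Fin (suc n) → Bool) → Fin n → Fin n → Bool
shift r i j = r (suc i) (suc j)

shift-isEquivalenceᵇ : {r : Fin (suc n) → Fin (suc n) → Bool} → IsEquivalenceᵇ r → IsEquivalenceᵇ (shift r)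
shift-isEquivalenceᵇ = On.isEquivalence suc

shift-hasShortBlocks : {r : Fin (suc n) → Fin (suc n) → Bool} → HasShortBlocks r → HasShortBlocks (shift r)
shift-hasShortBlocks short i j le = short (suc i) (suc j) (s≤s le)

module _ {r : Fin (2 + n) → Fin (2 + n) → Bool} (E : IsEquivalenceᵇ r) (short : HasShortBlocks r) where
  open IsEquivalence E using () renaming (refl to ~-refl; sym to ~-sym; trans to ~-trans)

  private
    false-sym : ∀ {i j} → r i j ≡ false → r j i ≡ false
    false-sym i≁j = ¬-not λ j~i → not-¬ i≁j (~-sym j~i)

    0≁2+ : ∀ j → r 0F (suc (suc j)) ≡ false
    0≁2+ j = short 0F (suc (suc j)) (s≤s (s≤s z≤n))

    1≁2+ : r 0F 1F ≡ true → ∀ j → r 1F (suc (suc j)) ≡ false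
    1≁2+ r₀₁ j = ¬-not λ 1~ → not-¬ (0≁2+ j) (~-trans r₀₁ 1~)

  describes-mono : {t : Tiling (suc n)} → r 0F 1F ≡ false → Describes t (shift r) → Describes (mono t) r
  describes-mono r₀₁ d zero          zero          = ~-refl
  describes-mono r₀₁ d zero          (suc zero)    = r₀₁
  describes-mono r₀₁ d zero          (suc (suc j)) = 0≁2+ j
  describes-mono r₀₁ d (suc zero)    zero          = false-sym r₀₁
  describes-mono r₀₁ d (suc (suc i)) zero          = false-sym (0≁2+ i)
  describes-mono r₀₁ d (suc i)       (suc j)       = d i j

  describes-domino : {t : Tiling n} → r 0F 1F ≡ true → Describes t (shift (shift r)) → Describes (domino t) r
  describes-domino r₀₁ d zero          zero          = ~-refl
  describes-domino r₀₁ d zero          (suc zero)    = r₀₁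
  describes-domino r₀₁ d (suc zero)    zero          = ~-sym r₀₁
  describes-domino r₀₁ d (suc zero)    (suc zero)    = ~-refl
  describes-domino r₀₁ d zero          (suc (suc j)) = 0≁2+ j
  describes-domino r₀₁ d (suc zero)    (suc (suc j)) = 1≁2+ r₀₁ j
  describes-domino r₀₁ d (suc (suc i)) zero          = false-sym (0≁2+ i)
  describes-domino r₀₁ d (suc (suc i)) (suc zero)    = false-sym (1≁2+ r₀₁ i)
  describes-domino r₀₁ d (suc (suc i)) (suc (suc j)) = d i j

  describes-by-first-pair : ∀ b → r 0F 1F ≡ b →
                            Σ (Tiling (suc n)) (λ t → Describes t (shift r)) →
                            Σ (Tiling n) (λ t → Describes t (shift (shift r))) →
                            Σ (Tiling (2 + n)) λ t → Describes t r
  describes-by-first-pair false r₀₁ (t , d) _       = mono t , describes-mono r₀₁ d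
  describes-by-first-pair true  r₀₁ _       (t , d) = domino t , describes-domino r₀₁ d

shortEquivalence⇒tiling : (r : Fin n → Fin n → Bool) → IsEquivalenceᵇ r → HasShortBlocks r →
                          Σ (Tiling n) λ t → Describes t r
shortEquivalence⇒tiling {zero}        r E short = end , λ ()
shortEquivalence⇒tiling {suc zero}    r E short = mono end , λ { zero zero → IsEquivalence.refl E }
shortEquivalence⇒tiling {suc (suc n)} r E short = describes-by-first-pair E short (r 0F 1F) refl
  (shortEquivalence⇒tiling (shift r) (shift-isEquivalenceᵇ E) (shift-hasShortBlocks short))
  (shortEquivalence⇒tiling (shift (shift r)) (shift-isEquivalenceᵇ (shift-isEquivalenceᵇ E))
                           (shift-hasShortBlocks (shift-hasShortBlocks short)))

inΠ⇒tiling : {σ : Rel n} → InΠ σ → Σ (Tiling n) λ t → σ ≡ ⟦ t ⟧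
inΠ⇒tiling {σ = σ} inΠ@(P , _) =
  let t , d = shortEquivalence⇒tiling (rel σ) (isSetPartition⇒isEquivalenceᵇ P) (inΠ⇒hasShortBlocks inΠ)
  in t , tabulate²-rel d

-- Number of blocks and sign of a tiling's partition

allᵇ-const-true : {A : Set} (xs : List A) → allᵇ (λ _ → true) xs ≡ true
allᵇ-const-true []       = refl
allᵇ-const-true (_ ∷ xs) = allᵇ-const-true xs

allᵇ-tabulate-cong : {A B : Set} {f : Fin n → A} {g : Fin n → B} {p : A → Bool} {q : B → Bool} →
                     (∀ i → p (f i) ≡ q (g i)) → allᵇ p (List.tabulate f) ≡ allᵇ q (List.tabulate g)
allᵇ-tabulate-cong {zero}  eq = refl
allᵇ-tabulate-cong {suc n} eq = cong₂ _∧_ (eq zero) (allᵇ-tabulate-cong (eq ∘ suc))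

length-filterᵇ-tabulate-cong : {A B : Set} {f : Fin n → A} {g : Fin n → B} {p : A → Bool} {q : B → Bool} →
                               (∀ i → p (f i) ≡ q (g i)) →
                               length (filterᵇ p (List.tabulate f)) ≡ length (filterᵇ q (List.tabulate g))
length-filterᵇ-tabulate-cong {zero} eq = refl
length-filterᵇ-tabulate-cong {suc n} {f = f} {g} {p} {q} eq with p (f zero) | q (g zero) | eq zero
... | true  | true  | _ = cong suc (length-filterᵇ-tabulate-cong (eq ∘ suc))
... | false | false | _ = length-filterᵇ-tabulate-cong (eq ∘ suc)

allᵇ-allFin-suc : (p : Fin (suc n) → Bool) → allᵇ p (allFin (suc n)) ≡ p zero ∧ allᵇ (p ∘ Fin.suc) (allFin n)
allᵇ-allFin-suc p = cong (p zero ∧_) (allᵇ-tabulate-cong {f = Fin.suc} {g = id} {p = p} {q = p ∘ Fin.suc} λ _ → refl)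

length-filterᵇ-allFin-suc : (p : Fin (suc n) → Bool) →
  length (filterᵇ p (allFin (suc n))) ≡ (if p zero then 1 else 0) + length (filterᵇ (p ∘ Fin.suc) (allFin n))
length-filterᵇ-allFin-suc p with p zero
... | true  = cong suc (length-filterᵇ-tabulate-cong {f = Fin.suc} {g = id} {p = p} {q = p ∘ Fin.suc} λ _ → refl)
... | false = length-filterᵇ-tabulate-cong {f = Fin.suc} {g = id} {p = p} {q = p ∘ Fin.suc} λ _ → refl

isBlockMinimum : (Fin n → Fin n → Bool) → Fin n → Bool
isBlockMinimum {n} r i = allᵇ (λ j → not ((toℕ j <ᵇ toℕ i) ∧ r j i)) (allFin n)

blockMinima : (Fin n → Fin n → Bool) → ℕ
blockMinima {n} r = length (filterᵇ (isBlockMinimum r) (allFin n))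

blocks-tabulate² : (r : Fin n → Fin n → Bool) → blocks (tabulate² r) ≡ blockMinima r
blocks-tabulate² r = length-filterᵇ-tabulate-cong λ i → allᵇ-tabulate-cong λ j →
  cong (λ b → not ((toℕ j <ᵇ toℕ i) ∧ b)) (rel-tabulate² r j i)

isBlockMinimum-suc : (r : Fin (suc n) → Fin (suc n) → Bool) (i : Fin n) →
                     isBlockMinimum r (suc i) ≡ not (r zero (suc i)) ∧ isBlockMinimum (shift r) i
isBlockMinimum-suc r i = allᵇ-allFin-suc λ j → not ((toℕ j <ᵇ toℕ (Fin.suc i)) ∧ r j (Fin.suc i))

blockMinima-suc : (r : Fin (suc n) → Fin (suc n) → Bool) →
                  blockMinima r ≡
                  suc (length (filterᵇ (λ i → not (r zero (suc i)) ∧ isBlockMinimum (shift r) i) (allFin n)))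
blockMinima-suc {n} r = begin
  blockMinima r
    ≡⟨ length-filterᵇ-allFin-suc (isBlockMinimum r) ⟩
  (if isBlockMinimum r zero then 1 else 0) + length (filterᵇ (isBlockMinimum r ∘ Fin.suc) (allFin n))
    ≡⟨ cong₂ _+_ (cong (if_then 1 else 0) (allᵇ-const-true (allFin (suc n))))
                 (length-filterᵇ-tabulate-cong (isBlockMinimum-suc r)) ⟩
  suc (length (filterᵇ (λ i → not (r zero (suc i)) ∧ isBlockMinimum (shift r) i) (allFin n))) ∎
  where open ≡-Reasoning

blockMinima-mono : (t : Tiling n) → blockMinima (sameTile (mono t)) ≡ suc (blockMinima (sameTile t))
blockMinima-mono t = blockMinima-suc (sameTile (mono t))

blockMinima-domino : (t : Tiling n) → blockMinima (sameTile (domino t)) ≡ suc (blockMinima (sameTile t))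
blockMinima-domino {n} t = trans (blockMinima-suc r) (cong suc (trans
  (length-filterᵇ-allFin-suc λ i → not (r zero (suc i)) ∧ isBlockMinimum (shift r) i)
  (length-filterᵇ-tabulate-cong {f = id} {g = id} (isBlockMinimum-suc (shift r)))))
  where
  r : Fin (2 + n) → Fin (2 + n) → Bool
  r = sameTile (domino t)

blockMinima-sameTile : (t : Tiling n) → blockMinima (sameTile t) + dominoes t ≡ n
blockMinima-sameTile end                = refl
blockMinima-sameTile (mono t)           = trans (cong (_+ dominoes t) (blockMinima-mono t)) (cong suc (blockMinima-sameTile t))
blockMinima-sameTile (domino {n} t)     = begin
  blockMinima (sameTile (domino t)) + suc (dominoes t) ≡⟨ cong (_+ suc (dominoes t)) (blockMinima-domino t) ⟩
  suc (blockMinima (sameTile t) + suc (dominoes t))    ≡⟨ cong suc (+-suc _ (dominoes t)) ⟩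
  suc (suc (blockMinima (sameTile t) + dominoes t))    ≡⟨ cong (λ m → 2 + m) (blockMinima-sameTile t) ⟩
  suc (suc n)                                          ∎
  where open ≡-Reasoning

∸-blocks⟦⟧ : (t : Tiling n) → n ∸ blocks ⟦ t ⟧ ≡ dominoes t
∸-blocks⟦⟧ {n} t = begin
  n ∸ blocks ⟦ t ⟧         ≡⟨ cong (n ∸_) (blocks-tabulate² (sameTile t)) ⟩
  n ∸ b                    ≡⟨ cong (_∸ b) (sym (blockMinima-sameTile t)) ⟩
  b + dominoes t ∸ b       ≡⟨ m+n∸m≡n b (dominoes t) ⟩
  dominoes t               ∎
  where
  open ≡-Reasoning
  b : ℕ
  b = blockMinima (sameTile t)

-- Counting partitions by sign

mono-injective : {s t : Tiling n} → mono s ≡ mono t → s ≡ t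
mono-injective refl = refl

domino-injective : {s t : Tiling n} → domino s ≡ domino t → s ≡ t
domino-injective refl = refl

-- Splitting on n before p makes tilings p (suc n) reduce for a variable parity p.
tilings : Parity → (n : ℕ) → List (Tiling n)
tilings p  (suc zero)    = map mono (tilings p zero)
tilings p  (suc (suc n)) = map mono (tilings p (suc n)) ++ map domino (tilings (p ⁻¹) n)
tilings 0ℙ zero          = end ∷ []
tilings 1ℙ zero          = []

∈-tilings⁺ : (t : Tiling n) → t ∈ tilings (parity (dominoes t)) n
∈-tilings⁺ end                = here refl
∈-tilings⁺ (mono {zero} t)    = ∈-map⁺ mono (∈-tilings⁺ t)
∈-tilings⁺ (mono {suc n} t)   = ∈-++⁺ˡ (∈-map⁺ mono (∈-tilings⁺ t))
∈-tilings⁺ (domino {n} t)     = ∈-++⁺ʳ (map mono (tilings _ (suc n)))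
  (∈-map⁺ domino (subst (λ p → t ∈ tilings p n) (sym (suc-homo-⁻¹ (dominoes t))) (∈-tilings⁺ t)))

∈-tilings⁻ : ∀ {p} n {t : Tiling n} → t ∈ tilings p n → parity (dominoes t) ≡ p
∈-tilings⁻ {0ℙ} zero (here refl) = refl
∈-tilings⁻ (suc zero) t∈ with ∈-map⁻ mono t∈
... | t , t∈′ , refl = ∈-tilings⁻ zero t∈′
∈-tilings⁻ {p} (suc (suc n)) t∈ with ∈-++⁻ (map mono (tilings p (suc n))) t∈
... | inj₁ t∈mono with ∈-map⁻ mono t∈mono
...   | t , t∈′ , refl = ∈-tilings⁻ (suc n) t∈′
∈-tilings⁻ {p} (suc (suc n)) t∈ | inj₂ t∈domino with ∈-map⁻ domino t∈domino
...   | t , t∈′ , refl = ⁻¹-injective (trans (suc-homo-⁻¹ (dominoes t)) (∈-tilings⁻ n t∈′))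

tilings-unique : ∀ p n → Unique (tilings p n)
tilings-unique 0ℙ zero          = [] ∷ []
tilings-unique 1ℙ zero          = []
tilings-unique p  (suc zero)    = Unique.map⁺ mono-injective (tilings-unique p zero)
tilings-unique p  (suc (suc n)) = Unique.++⁺ (Unique.map⁺ mono-injective (tilings-unique p (suc n)))
                                             (Unique.map⁺ domino-injective (tilings-unique (p ⁻¹) n))
                                             mono-domino-disjoint
  where
  mono-domino-disjoint : ∀ {t} → ¬ (t ∈ map mono (tilings p (suc n)) × t ∈ map domino (tilings (p ⁻¹) n))
  mono-domino-disjoint (∈mono , ∈domino) with ∈-map⁻ mono ∈mono | ∈-map⁻ domino ∈domino
  ... | _ , _ , refl | _ , _ , ()

tilingCount : Parity → ℕ → ℕ
tilingCount p n = length (tilings p n)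

tilingCount-suc-suc : ∀ p n → tilingCount p (2 + n) ≡ tilingCount p (1 + n) + tilingCount (p ⁻¹) n
tilingCount-suc-suc p n = trans (length-++ (map mono (tilings p (suc n))))
  (cong₂ _+_ (length-map mono (tilings p (suc n))) (length-map domino (tilings (p ⁻¹) n)))

remainder : Parity → ℕ
remainder 0ℙ = 0
remainder 1ℙ = 1

remainder-injective : ∀ {p q} → remainder p ≡ remainder q → p ≡ q
remainder-injective {0ℙ} {0ℙ} _ = refl
remainder-injective {1ℙ} {1ℙ} _ = refl

%2≡remainder∘parity : ∀ m → m % 2 ≡ remainder (parity m)
%2≡remainder∘parity zero          = refl
%2≡remainder∘parity (suc zero)    = refl
%2≡remainder∘parity (suc (suc m)) = trans (%-congˡ (+-comm 2 m)) (trans ([m+n]%n≡m%n m 2) (%2≡remainder∘parity m))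

⟦⟧-sign : (t : Tiling n) → (n ∸ blocks ⟦ t ⟧) % 2 ≡ remainder (parity (dominoes t))
⟦⟧-sign t = trans (cong (_% 2) (∸-blocks⟦⟧ t)) (%2≡remainder∘parity (dominoes t))

∈-⟦tilings⟧⇔ : ∀ p n (σ : Rel n) →
               σ ∈ map ⟦_⟧ (tilings p n) ⇔ (InΠ σ × (n ∸ blocks σ) % 2 ≡ remainder p)
∈-⟦tilings⟧⇔ p n σ = mk⇔ to from
  where
  to : σ ∈ map ⟦_⟧ (tilings p n) → InΠ σ × (n ∸ blocks σ) % 2 ≡ remainder p
  to σ∈ with ∈-map⁻ ⟦_⟧ σ∈
  ... | t , t∈ , refl = ⟦⟧-inΠ t , trans (⟦⟧-sign t) (cong remainder (∈-tilings⁻ n t∈))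
  from : InΠ σ × (n ∸ blocks σ) % 2 ≡ remainder p → σ ∈ map ⟦_⟧ (tilings p n)
  from (inΠ , sign) with inΠ⇒tiling inΠ
  ... | t , refl = ∈-map⁺ ⟦_⟧ (subst (λ q → t ∈ tilings q n) parity≡p (∈-tilings⁺ t))
    where
    parity≡p : parity (dominoes t) ≡ p
    parity≡p = remainder-injective (trans (sym (⟦⟧-sign t)) sign)

signedPartitions-hasCard : ∀ p n →
  HasCard {Rel n} (λ σ → InΠ σ × (n ∸ blocks σ) % 2 ≡ remainder p) (tilingCount p n)
signedPartitions-hasCard p n = map ⟦_⟧ (tilings p n) , Unique.map⁺ ⟦⟧-injective (tilings-unique p n)
                             , length-map ⟦_⟧ (tilings p n) , ∈-⟦tilings⟧⇔ p n

tilingCount-total : ∀ n → tilingCount 0ℙ n + tilingCount 1ℙ n ≡ F n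
tilingCount-total zero          = refl
tilingCount-total (suc zero)    = refl
tilingCount-total (suc (suc n)) = begin
  tilingCount 0ℙ (2 + n) + tilingCount 1ℙ (2 + n)
    ≡⟨ cong₂ _+_ (tilingCount-suc-suc 0ℙ n) (tilingCount-suc-suc 1ℙ n) ⟩
  (e′ + o) + (o′ + e) ≡⟨ interchange +-commutativeSemigroup e′ o o′ e ⟩
  (e′ + o′) + (o + e) ≡⟨ cong₂ _+_ (tilingCount-total (suc n)) (+-comm o e) ⟩
  F (1 + n) + (e + o) ≡⟨ cong (λ m → F (1 + n) + m) (tilingCount-total n) ⟩
  F (1 + n) + F n     ∎
  where
  open ≡-Reasoning
  e o e′ o′ : ℕ
  e  = tilingCount 0ℙ n
  o  = tilingCount 1ℙ n
  e′ = tilingCount 0ℙ (1 + n)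
  o′ = tilingCount 1ℙ (1 + n)

signedCount : ℕ → ℤ
signedCount n = + tilingCount 0ℙ n - + tilingCount 1ℙ n

signedCount-suc-suc : ∀ n → signedCount (2 + n) ≡ signedCount (1 + n) - signedCount n
signedCount-suc-suc n = begin
  + tilingCount 0ℙ (2 + n) - + tilingCount 1ℙ (2 + n)
    ≡⟨ cong₂ (λ a b → + a - + b) (tilingCount-suc-suc 0ℙ n) (tilingCount-suc-suc 1ℙ n) ⟩
  + (e′ + o) - + (o′ + e)               ≡⟨ cong₂ _-_ (pos-+ e′ o) (pos-+ o′ e) ⟩
  (+ e′ ℤ.+ + o) - (+ o′ ℤ.+ + e)       ≡⟨ rearrange (+ e′) (+ o) (+ o′) (+ e) ⟩
  (+ e′ - + o′) - (+ e - + o)           ∎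
  where
  open ≡-Reasoning
  e o e′ o′ : ℕ
  e  = tilingCount 0ℙ n
  o  = tilingCount 1ℙ n
  e′ = tilingCount 0ℙ (1 + n)
  o′ = tilingCount 1ℙ (1 + n)
  rearrange : ∀ a b c d → (a ℤ.+ b) - (c ℤ.+ d) ≡ (a - c) - (d - b)
  rearrange = solve-∀

signedCount-antiperiodic : ∀ n → signedCount (3 + n) ≡ - signedCount n
signedCount-antiperiodic n = begin
  signedCount (3 + n)                                         ≡⟨ signedCount-suc-suc (1 + n) ⟩
  signedCount (2 + n) - signedCount (1 + n)                   ≡⟨ cong (_- signedCount (1 + n)) (signedCount-suc-suc n) ⟩
  (signedCount (1 + n) - signedCount n) - signedCount (1 + n) ≡⟨ cancel (signedCount (1 + n)) (signedCount n) ⟩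
  - signedCount n                                             ∎
  where
  open ≡-Reasoning
  cancel : ∀ a b → (a - b) - a ≡ - b
  cancel = solve-∀

signedCount-periodic : ∀ n → signedCount (6 + n) ≡ signedCount n
signedCount-periodic n = begin
  signedCount (3 + (3 + n)) ≡⟨ signedCount-antiperiodic (3 + n) ⟩
  - signedCount (3 + n)     ≡⟨ cong -_ (signedCount-antiperiodic n) ⟩
  - - signedCount n         ≡⟨ neg-involutive (signedCount n) ⟩
  signedCount n             ∎
  where open ≡-Reasoning

signedCount-%6 : ∀ n → signedCount n ≡ signedCount (n % 6)
signedCount-%6 0 = refl
signedCount-%6 1 = refl
signedCount-%6 2 = refl
signedCount-%6 3 = refl
signedCount-%6 4 = refl
signedCount-%6 5 = refl
signedCount-%6 (suc (suc (suc (suc (suc (suc n)))))) = begin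
  signedCount (6 + n)       ≡⟨ signedCount-periodic n ⟩
  signedCount n             ≡⟨ signedCount-%6 n ⟩
  signedCount (n % 6)       ≡⟨ cong signedCount (sym ([m+n]%n≡m%n n 6)) ⟩
  signedCount ((n + 6) % 6) ≡⟨ cong (λ m → signedCount (m % 6)) (+-comm n 6) ⟩
  signedCount ((6 + n) % 6) ∎
  where open ≡-Reasoning

[+m]-[+n]≡+k⇒m≡k+n : ∀ m n k → + m - + n ≡ + k → m ≡ k + n
[+m]-[+n]≡+k⇒m≡k+n m n k eq = +-injective (begin
  + m                 ≡⟨ cancel (+ m) (+ n) ⟩
  (+ m - + n) ℤ.+ + n ≡⟨ cong (ℤ._+ + n) eq ⟩
  + k ℤ.+ + n         ∎)
  where
  open ≡-Reasoning
  cancel : ∀ a b → a ≡ (a - b) ℤ.+ b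
  cancel = solve-∀

[+m]-[+n]≡-[+k]⇒n≡k+m : ∀ m n k → + m - + n ≡ - + k → n ≡ k + m
[+m]-[+n]≡-[+k]⇒n≡k+m m n k eq = [+m]-[+n]≡+k⇒m≡k+n n m k (begin
  + n - + m       ≡⟨ negate (+ m) (+ n) ⟩
  - (+ m - + n)   ≡⟨ cong -_ eq ⟩
  - - + k         ≡⟨ neg-involutive (+ k) ⟩
  + k             ∎)
  where
  open ≡-Reasoning
  negate : ∀ a b → b - a ≡ - (a - b)
  negate = solve-∀

[1+m*2]/2≡m : ∀ m → (1 + m * 2) / 2 ≡ m
[1+m*2]/2≡m m = trans (+-distrib-/-∣ʳ 1 (n∣m*n m {2})) (m*n/n≡m m 2)

halves-of-successor : ∀ {a b} → a ≡ suc b → a ≡ (a + b + 1) / 2 × b ≡ (a + b) / 2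
halves-of-successor {b = b} refl =
  sym (trans (cong (_/ 2) (even-form b)) (m*n/n≡m (suc b) 2)) ,
  sym (trans (cong (_/ 2) (odd-form b)) ([1+m*2]/2≡m b))
  where
  even-form : ∀ b → suc b + b + 1 ≡ suc b * 2
  even-form = ℕ-solve-∀
  odd-form : ∀ b → suc b + b ≡ 1 + b * 2
  odd-form = ℕ-solve-∀

halves-of-equal : ∀ {a b} → a ≡ b → 2 * a ≡ a + b × 2 * b ≡ a + b
halves-of-equal {a} refl = double , double
  where double : 2 * a ≡ a + a
        double = cong (λ m → a + m) (+-identityʳ a)

proposition4p7 : (n : ℕ) →
    Σ ℕ λ e → Σ ℕ λ o →
      HasCard {Rel n} (λ σ → InΠ σ × Even σ) e
      × HasCard {Rel n} (λ σ → InΠ σ × Odd σ) o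
      × ((n % 6 ≡ 0 ⊎ n % 6 ≡ 1) → e ≡ (F n + 1) / 2 × o ≡ F n / 2)
      × ((n % 6 ≡ 2 ⊎ n % 6 ≡ 5) → 2 * e ≡ F n × 2 * o ≡ F n)
      × ((n % 6 ≡ 3 ⊎ n % 6 ≡ 4) → e ≡ F n / 2 × o ≡ (F n + 1) / 2)
proposition4p7 n = e , o , signedPartitions-hasCard 0ℙ n , signedPartitions-hasCard 1ℙ n
                 , evenAhead , balanced , oddAhead
  where
  e o : ℕ
  e = tilingCount 0ℙ n
  o = tilingCount 1ℙ n
  signedCount≡ : ∀ r → n % 6 ≡ r → signedCount n ≡ signedCount r
  signedCount≡ r n%6≡r = trans (signedCount-%6 n) (cong signedCount n%6≡r)
  F≡e+o : F n ≡ e + o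
  F≡e+o = sym (tilingCount-total n)
  evenAhead : (n % 6 ≡ 0 ⊎ n % 6 ≡ 1) → e ≡ (F n + 1) / 2 × o ≡ F n / 2
  evenAhead h rewrite F≡e+o =
    halves-of-successor ([+m]-[+n]≡+k⇒m≡k+n e o 1 ([ signedCount≡ 0 , signedCount≡ 1 ]′ h))
  balanced : (n % 6 ≡ 2 ⊎ n % 6 ≡ 5) → 2 * e ≡ F n × 2 * o ≡ F n
  balanced h rewrite F≡e+o =
    halves-of-equal ([+m]-[+n]≡+k⇒m≡k+n e o 0 ([ signedCount≡ 2 , signedCount≡ 5 ]′ h))
  oddAhead : (n % 6 ≡ 3 ⊎ n % 6 ≡ 4) → e ≡ F n / 2 × o ≡ (F n + 1) / 2
  oddAhead h rewrite F≡e+o | +-comm e o =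
    swap (halves-of-successor ([+m]-[+n]≡-[+k]⇒n≡k+m e o 1 ([ signedCount≡ 3 , signedCount≡ 4 ]′ h)))
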